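{- Let $\mathcal{D}$ be a binary $q$-analog of the Fano plane (a set of $3$-dimensional subspaces of $\mathbb{F}_2^7$ such that every $2$-dimensional subspace is contained in exactly one member of $\mathcal{D}$). Then $\mathcal{D}$ is not invariant under any subgroup of $\mathrm{GL}(7,2)$ of order $31$.
   Context: Vectors are row vectors; $A\in\mathrm{GL}(7,2)$ acts on subspaces by $U\mapsto UA=\{\mathbf{u}A:\mathbf{u}\in U\}$ and on sets of subspaces elementwise. $\mathcal{D}$ is $G$-invariant if $\{BA:B\in\mathcal{D}\}=\mathcal{D}$ for all $A\in G$. -}

module Defs where

open import Data.Bool using (Bool; true; false; _xor_; if_then_else_)
open import Data.Nat using (ℕ; zero; suc)
open import Data.Vec using (Vec; []; _∷_; replicate; zipWith; map)
open import Data.List using (List; length)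
open import Data.List.Membership.Propositional using (_∈_)
open import Data.List.Relation.Unary.Any using (Any)
open import Data.List.Relation.Unary.Unique.Propositional using (Unique)
open import Data.Product using (Σ; ∃; _×_; proj₁)
open import Relation.Binary.PropositionalEquality using (_≡_)

-- The field F₂ is Bool with xor as addition and ∧ as multiplication.
-- Row vectors of F₂ⁿ.
Vecₙ : ℕ → Set
Vecₙ n = Vec Bool n

V : Set
V = Vecₙ 7

zeroV : V
zeroV = replicate 7 false

_⊕_ : V → V → V
_⊕_ = zipWith _xor_

scale : Bool → V → V
scale b v = if b then v else zeroV

lincomb : {k : ℕ} → Vecₙ k → Vec V k → V
lincomb [] [] = zeroV
lincomb (c ∷ cs) (b ∷ bs) = scale c b ⊕ lincomb cs bs

Independent : {k : ℕ} → Vec V k → Set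
Independent {k} bs = (c : Vecₙ k) → lincomb c bs ≡ zeroV → c ≡ replicate k false

VSet : Set₁
VSet = V → Set

Span : {k : ℕ} → Vec V k → VSet
Span {k} bs v = Σ (Vecₙ k) (λ c → lincomb c bs ≡ v)

Subspace : ℕ → Set
Subspace k = Σ (Vec V k) Independent

⟦_⟧ : {k : ℕ} → Subspace k → VSet
⟦ U ⟧ = Span (proj₁ U)

_⊆ᵥ_ : VSet → VSet → Set
S ⊆ᵥ T = ∀ v → S v → T v

_≐_ : VSet → VSet → Set
S ≐ T = (S ⊆ᵥ T) × (T ⊆ᵥ S)

-- 7×7 matrices over F₂, given by their rows
Matrix : Set
Matrix = Vec V 7

_·_ : V → Matrix → V
u · A = lincomb u A

_*ₘ_ : Matrix → Matrix → Matrix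
A *ₘ B = map (λ r → r · B) A

unitV : (n : ℕ) → Data.Vec.Vec (Vec Bool 7) n
unitV n = Data.Vec.tabulate {n = n} (λ i → Data.Vec.tabulate λ j → isEq (Data.Fin.toℕ i) (Data.Fin.toℕ j))
  where
  open import Data.Fin using (Fin)
  isEq : ℕ → ℕ → Bool
  isEq zero zero = true
  isEq zero (suc _) = false
  isEq (suc _) zero = false
  isEq (suc m) (suc n) = isEq m n

Iₘ : Matrix
Iₘ = unitV 7

Invertible : Matrix → Set
Invertible A = Σ Matrix (λ B → (A *ₘ B ≡ Iₘ) × (B *ₘ A ≡ Iₘ))

_·ₛ_ : VSet → Matrix → VSet
(S ·ₛ A) v = Σ V (λ u → S u × (u · A ≡ v))

-- a finite set of 3-dimensional subspaces, given as a list (duplicates harmless)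
SubspaceSet : Set
SubspaceSet = List (Subspace 3)

IsQFano : SubspaceSet → Set
IsQFano 𝒟 =
  (W : Subspace 2) →
    Σ (Subspace 3) (λ C → (C ∈ 𝒟) × (⟦ W ⟧ ⊆ᵥ ⟦ C ⟧)
       × ((C' : Subspace 3) → C' ∈ 𝒟 → ⟦ W ⟧ ⊆ᵥ ⟦ C' ⟧ → ⟦ C' ⟧ ≐ ⟦ C ⟧))

-- {BA : B ∈ 𝒟} = 𝒟  (as sets of subspaces, subspaces compared as sets of vectors)
InvariantUnder : SubspaceSet → Matrix → Set
InvariantUnder 𝒟 A =
  ((B : Subspace 3) → B ∈ 𝒟 → Any (λ C → ⟦ C ⟧ ≐ (⟦ B ⟧ ·ₛ A)) 𝒟)
  × ((C : Subspace 3) → C ∈ 𝒟 → Any (λ B → (⟦ B ⟧ ·ₛ A) ≐ ⟦ C ⟧) 𝒟)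

record IsSubgroupGL (G : List Matrix) : Set where
  field
    distinct  : Unique G
    invertible : (A : Matrix) → A ∈ G → Invertible A
    hasId     : Iₘ ∈ G
    closedMul : (A B : Matrix) → A ∈ G → B ∈ G → (A *ₘ B) ∈ G
    closedInv : (A : Matrix) → A ∈ G → Σ Matrix (λ B → (B ∈ G) × (A *ₘ B ≡ Iₘ) × (B *ₘ A ≡ Iₘ))

GInvariant : SubspaceSet → List Matrix → Set
GInvariant 𝒟 G = (A : Matrix) → A ∈ G → InvariantUnder 𝒟 A

module Submission where

-- Let A ∈ G with A ≠ I.  By Lagrange A³¹ = I, and since 31 is prime every vector moved by A
-- lies in an orbit of exactly 31 vectors; hence the number f of vectors fixed by A satisfies
-- f ≡ 128 (mod 31), so f ≥ 4 and A fixes some 2-dimensional subspace W pointwise.  The block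
-- C ∈ 𝒟 through W is mapped by A onto a block through W = WA, i.e. onto C itself.  An
-- A-invariant set of 8 vectors cannot contain an orbit of size 31, so C is fixed pointwise, and
-- then the fixed vectors form a union of cosets of C, so 8 ∣ f.  The only such f is 128: A = I.

open import Defs
open import Algebra.Bundles using (Monoid; AbelianGroup)
open import Algebra.Core using (Op₂)
open import Algebra.Structures using (IsMonoid; IsAbelianGroup)
import Algebra.Properties.AbelianGroup as AbelianGroupProperties
import Algebra.Properties.CommutativeSemigroup as CommutativeSemigroupProperties
import Algebra.Properties.Monoid.Mult as Mult
open import Data.Bool using (Bool; true; false; _xor_)
import Data.Bool.Properties as Bool
open import Data.Fin using (Fin; toℕ; fromℕ<)
open import Data.Fin.Properties using (toℕ<n; toℕ-fromℕ<; toℕ-injective; pigeonhole)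
open import Data.List using (List; []; _∷_; _++_; length; filter; map; tabulate; lookup)
open import Data.List.Properties using (length-map; length-++; length-tabulate; length-filter; filter-notAll; filter-complete)
open import Data.List.Membership.Propositional using (_∈_; _∉_; find; lose)
import Data.List.Membership.DecPropositional as DecMembership
open import Data.List.Membership.Propositional.Properties
  using (∈-map⁺; ∈-map⁻; ∈-++⁺ˡ; ∈-++⁺ʳ; ∈-tabulate⁺; ∈-tabulate⁻; ∈-filter⁺; ∈-filter⁻)
open import Data.List.Relation.Binary.Subset.Propositional using (_⊆_)
open import Data.List.Relation.Unary.All as All using ([]; all?)
open import Data.List.Relation.Unary.AllPairs using ([]; _∷_)
open import Data.List.Relation.Unary.Any as Any using (here; there; any?; index)
open import Data.List.Relation.Unary.Any.Properties using (lookup-index)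
open import Data.List.Relation.Unary.Unique.Propositional using (Unique)
open import Data.List.Relation.Unary.Unique.Propositional.Properties
  using (map⁺; tabulate⁺; filter⁺; ++⁺; Unique[x∷xs]⇒x∉xs)
open import Data.Nat using (ℕ; zero; suc; _+_; _*_; _∸_; _≤_; _<_; s≤s; z≤n; _≤?_; NonZero; >-nonZero; _%_; _/_)
import Data.Nat as ℕ
open import Data.Nat.Properties
  using ( ≤-refl; ≤-trans; ≤-antisym; ≤-pred; <⇒≤; <⇒≱; ≤-<-trans; <-cmp; n<1+n; n≤1+n; +-suc; +-comm; +-identityʳ
        ; m+[n∸m]≡n; m+n∸m≡n; m∸n≤m; m<n⇒0<n∸m; m≤n⇒∃[o]m+o≡n; anyUpTo?; allUpTo?)
open import Data.Nat.DivMod using (m≡m%n+[m/n]*n; m%n<n)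
open import Data.Nat.Divisibility using (_∣_; _∣?_; divides; _∣0; ∣-refl; ∣m∣n⇒∣m+n)
open import Data.Nat.GCD using (module Bézout)
open import Data.Nat.Coprimality using (prime⇒coprime; coprime-Bézout)
open import Data.Nat.Induction using (<-rec)
open import Data.Nat.Primality using (Prime; prime?; prime⇒nonZero)
open import Data.Product using (Σ; ∃; _×_; _,_; proj₁; proj₂)
open import Data.Unit using (tt)
open import Data.Vec using (Vec; []; _∷_; replicate; zipWith) renaming (map to mapᵥ; _++_ to _++ᵥ_)
open import Data.Vec.Properties using (≡-dec; ∷-injectiveʳ; map-cong; map-id; map-∘)
open import Data.Vec.Relation.Binary.Pointwise.Inductive
  using ([]; _∷_; Pointwise-≡⇒≡; zipWith-assoc; zipWith-comm; zipWith-identityˡ; zipWith-identityʳ)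
open import Function using (id; _∘_)
open import Level using (0ℓ)
open import Relation.Binary.Definitions using (DecidableEquality; tri<; tri≈; tri>)
open import Relation.Binary.PropositionalEquality
open import Relation.Nullary using (¬_; yes; no; ¬?; contradiction)
open import Relation.Nullary.Decidable using (toWitness; from-yes; from-no; decidable-stable; _→-dec_)
open import Relation.Unary using (Pred; Decidable; ∁)
open import Relation.Unary.Properties using (∁?)

least-witness : {P : Pred ℕ 0ℓ} → Decidable P → ∀ n → P n → ∃ λ m → P m × (∀ {k} → k < m → ¬ P k)
least-witness {P} P? = <-rec (λ n → P n → ∃ λ m → P m × (∀ {k} → k < m → ¬ P k)) least
  where
  least : ∀ n → (∀ {m} → m < n → P m → ∃ λ k → P k × (∀ {j} → j < k → ¬ P j)) → P n →
          ∃ λ m → P m × (∀ {k} → k < m → ¬ P k)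
  least n smaller Pn with anyUpTo? P? n
  ... | yes (m , m<n , Pm) = smaller m<n Pm
  ... | no  none           = n , Pn , λ k<n Pk → none (_ , k<n , Pk)

index-injective : ∀ {A : Set} {xs : List A} {x y} (x∈ : x ∈ xs) (y∈ : y ∈ xs) → index x∈ ≡ index y∈ → x ≡ y
index-injective {xs = xs} x∈ y∈ eq = trans (lookup-index x∈) (trans (cong (lookup xs) eq) (sym (lookup-index y∈)))

length-filter-∁ : ∀ {A : Set} {P : Pred A 0ℓ} (P? : Decidable P) (xs : List A) →
                  length (filter P? xs) + length (filter (∁? P?) xs) ≡ length xs
length-filter-∁ P? []       = refl
length-filter-∁ P? (x ∷ xs) with P? x
... | yes _ = cong suc (length-filter-∁ P? xs)
... | no  _ = trans (+-suc _ _) (cong suc (length-filter-∁ P? xs))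

module _ {A : Set} (_≟_ : DecidableEquality A) where

  open DecMembership _≟_ using (_∈?_)

  unique-⊆⇒length≤ : {xs ys : List A} → Unique xs → xs ⊆ ys → length xs ≤ length ys
  unique-⊆⇒length≤ {[]}     _            _     = z≤n
  unique-⊆⇒length≤ {x ∷ xs} {ys} u@(_ ∷ u′) xs⊆ys =
    ≤-trans (s≤s (unique-⊆⇒length≤ u′ xs⊆ys′))
            (filter-notAll ≢x? ys (Any.map (λ x≡y y≢x → y≢x (sym x≡y)) (xs⊆ys (here refl))))
    where
    ≢x? : Decidable (λ y → ¬ y ≡ x)
    ≢x? y = ¬? (y ≟ x)
    xs⊆ys′ : xs ⊆ filter ≢x? ys
    xs⊆ys′ y∈xs = ∈-filter⁺ ≢x? (xs⊆ys (there y∈xs)) λ { refl → Unique[x∷xs]⇒x∉xs u y∈xs }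

  unique-⊆⊇⇒length≡ : {xs ys : List A} → Unique xs → Unique ys → xs ⊆ ys → ys ⊆ xs → length xs ≡ length ys
  unique-⊆⊇⇒length≡ xs-unique ys-unique xs⊆ys ys⊆xs =
    ≤-antisym (unique-⊆⇒length≤ xs-unique xs⊆ys) (unique-⊆⇒length≤ ys-unique ys⊆xs)

  unique-length<⇒∉ : {xs ys : List A} → Unique xs → length ys < length xs → ∃ λ x → x ∈ xs × x ∉ ys
  unique-length<⇒∉ {xs} {ys} xs-unique |ys|<|xs| with any? (λ x → ¬? (x ∈? ys)) xs
  ... | yes some = find some
  ... | no  none = contradiction (unique-⊆⇒length≤ xs-unique xs⊆ys) (<⇒≱ |ys|<|xs|)
    where
    xs⊆ys : xs ⊆ ys
    xs⊆ys {x} x∈xs = decidable-stable (x ∈? ys) λ x∉ys → none (lose x∈xs x∉ys)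

  module OrbitPartition
    (P : Pred A 0ℓ) (orbit : A → List A) (m : ℕ)
    (orbit-unique : ∀ {x} → P x → Unique (orbit x))
    (orbit-length : ∀ {x} → P x → length (orbit x) ≡ m)
    (orbit-refl   : ∀ {x} → P x → x ∈ orbit x)
    (orbit-sym    : ∀ {x y} → P x → P y → y ∈ orbit x → x ∈ orbit y)
    (orbit-trans  : ∀ {x y z} → P x → P y → P z → y ∈ orbit x → z ∈ orbit y → z ∈ orbit x)
    where

    private
      orbit-length∣length′ : ∀ n (S : List A) → length S ≤ n → Unique S → (∀ {x} → x ∈ S → P x) →
                             (∀ {x} → x ∈ S → orbit x ⊆ S) → m ∣ length S
      orbit-length∣length′ _       []        _       _  _   _      = m ∣0
      orbit-length∣length′ (suc n) S@(x ∷ _) |S|≤1+n uS S⊆P closed =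
        subst (m ∣_) (length-filter-∁ in? S)
          (∣m∣n⇒∣m+n (subst (m ∣_) (sym |inside|≡m) ∣-refl)
                     (orbit-length∣length′ n outside |outside|≤n (filter⁺ out? uS)
                                           (S⊆P ∘ proj₁ ∘ ∈-filter⁻ out?) outside-closed))
        where
        Px = S⊆P (here refl)
        in? = _∈? orbit x
        out? = ∁? in?
        inside  = filter in? S
        outside = filter out? S
        |inside|≡m : length inside ≡ m
        |inside|≡m = trans (unique-⊆⊇⇒length≡ (filter⁺ in? uS) (orbit-unique Px)
                             (proj₂ ∘ ∈-filter⁻ in?) (λ y∈ → ∈-filter⁺ in? (closed (here refl) y∈) y∈))
                           (orbit-length Px)
        |outside|≤n : length outside ≤ n
        |outside|≤n = ≤-pred (≤-trans (filter-notAll out? S (here (λ x∉ → x∉ (orbit-refl Px)))) |S|≤1+n)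
        outside-closed : ∀ {y} → y ∈ outside → orbit y ⊆ outside
        outside-closed y∈ z∈ =
          let y∈S , y∉ = ∈-filter⁻ out? y∈
              Py = S⊆P y∈S
              z∈S = closed y∈S z∈
              Pz = S⊆P z∈S
          in ∈-filter⁺ out? z∈S λ z∈orbit → y∉ (orbit-trans Px Pz Py z∈orbit (orbit-sym Py Pz z∈))

    orbit-length∣length : (S : List A) → Unique S → (∀ {x} → x ∈ S → P x) →
                          (∀ {x} → x ∈ S → orbit x ⊆ S) → m ∣ length S
    orbit-length∣length S = orbit-length∣length′ (length S) S ≤-refl

module MonoidTheory {M : Set} {mul : Op₂ M} {ε : M} (isMonoid : IsMonoid _≡_ mul ε) where

  infixl 7 _∙_
  _∙_ : Op₂ M
  _∙_ = mul

  open IsMonoid isMonoid using (assoc; identityˡ; identityʳ)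

  private
    monoid : Monoid 0ℓ 0ℓ
    monoid = record { isMonoid = isMonoid }
    module Power = Mult monoid

  infixr 8 _^_
  _^_ : M → ℕ → M
  a ^ n = n Power.× a

  ^-multiple : ∀ {a d} → a ^ d ≡ ε → ∀ q → a ^ (q * d) ≡ ε
  ^-multiple a^d≡ε zero    = refl
  ^-multiple {a} {d} a^d≡ε (suc q) = begin
    a ^ (d + q * d)     ≡⟨ Power.×-homo-+ a d (q * d) ⟩
    a ^ d ∙ a ^ (q * d) ≡⟨ cong₂ _∙_ a^d≡ε (^-multiple a^d≡ε q) ⟩
    ε ∙ ε               ≡⟨ identityˡ ε ⟩
    ε                   ∎
    where open ≡-Reasoning

  ^-∣ : ∀ {a d n} → a ^ d ≡ ε → d ∣ n → a ^ n ≡ ε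
  ^-∣ a^d≡ε (divides q refl) = ^-multiple a^d≡ε q

  Cancellableˡ : Pred M 0ℓ
  Cancellableˡ x = ∀ {b c} → x ∙ b ≡ x ∙ c → b ≡ c

  left-invertible⇒cancellableˡ : ∀ {a b} → b ∙ a ≡ ε → Cancellableˡ a
  left-invertible⇒cancellableˡ {a} {b} b∙a≡ε {c} {c′} a∙c≡a∙c′ = begin
    c            ≡⟨ identityˡ c ⟨
    ε ∙ c        ≡⟨ cong (_∙ c) b∙a≡ε ⟨
    b ∙ a ∙ c    ≡⟨ assoc b a c ⟩
    b ∙ (a ∙ c)  ≡⟨ cong (b ∙_) a∙c≡a∙c′ ⟩
    b ∙ (a ∙ c′) ≡⟨ assoc b a c′ ⟨
    b ∙ a ∙ c′   ≡⟨ cong (_∙ c′) b∙a≡ε ⟩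
    ε ∙ c′       ≡⟨ identityˡ c′ ⟩
    c′           ∎
    where open ≡-Reasoning

  module RightAction {X : Set} (act : X → M → X)
    (act-identity : ∀ x → act x ε ≡ x) (act-∙ : ∀ x b c → act x (b ∙ c) ≡ act (act x b) c) (a : M) where

    infixl 7 _▷_
    _▷_ : X → M → X
    _▷_ = act

    ▷^-+ : ∀ x m n → x ▷ a ^ (m + n) ≡ (x ▷ a ^ m) ▷ a ^ n
    ▷^-+ x m n = trans (cong (x ▷_) (Power.×-homo-+ a m n)) (act-∙ x _ _)

    Fixed : Pred X 0ℓ
    Fixed x = x ▷ a ≡ x

    module Periodic (d : ℕ) .{{_ : NonZero d}} (a^d≡ε : a ^ d ≡ ε) where

      ▷^-mod : ∀ x n → x ▷ a ^ n ≡ x ▷ a ^ (n % d)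
      ▷^-mod x n = begin
        x ▷ a ^ n                          ≡⟨ cong (λ k → x ▷ a ^ k) (m≡m%n+[m/n]*n n d) ⟩
        x ▷ a ^ (n % d + (n / d) * d)      ≡⟨ ▷^-+ x (n % d) _ ⟩
        (x ▷ a ^ (n % d)) ▷ a ^ ((n / d) * d) ≡⟨ cong (x ▷ a ^ (n % d) ▷_) (^-multiple a^d≡ε (n / d)) ⟩
        (x ▷ a ^ (n % d)) ▷ ε              ≡⟨ act-identity (x ▷ a ^ (n % d)) ⟩
        x ▷ a ^ (n % d)                    ∎
        where open ≡-Reasoning

      orbit : X → List X
      orbit x = tabulate (λ (i : Fin d) → x ▷ a ^ toℕ i)

      orbit-length : ∀ x → length (orbit x) ≡ d
      orbit-length x = length-tabulate _

      ∈-orbit : ∀ x n → x ▷ a ^ n ∈ orbit x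
      ∈-orbit x n = subst (_∈ orbit x) (sym (trans (▷^-mod x n) (cong (λ k → x ▷ a ^ k) (sym (toℕ-fromℕ< n%d<d)))))
                          (∈-tabulate⁺ (fromℕ< n%d<d))
        where n%d<d = m%n<n n d

      ∈-orbit⁻ : ∀ {x y} → y ∈ orbit x → ∃ λ n → n < d × y ≡ x ▷ a ^ n
      ∈-orbit⁻ y∈ = let i , y≡ = ∈-tabulate⁻ y∈ in toℕ i , toℕ<n i , y≡

      orbit-refl : ∀ x → x ∈ orbit x
      orbit-refl x = subst (_∈ orbit x) (act-identity x) (∈-orbit x 0)

      orbit-sym : ∀ {x y} → y ∈ orbit x → x ∈ orbit y
      orbit-sym {x} y∈ with n , n<d , refl ← ∈-orbit⁻ y∈ =
        subst (_∈ orbit (x ▷ a ^ n)) x▷a^d≡x (∈-orbit (x ▷ a ^ n) (d ∸ n))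
        where
        x▷a^d≡x : (x ▷ a ^ n) ▷ a ^ (d ∸ n) ≡ x
        x▷a^d≡x = begin
          (x ▷ a ^ n) ▷ a ^ (d ∸ n) ≡⟨ ▷^-+ x n (d ∸ n) ⟨
          x ▷ a ^ (n + (d ∸ n))     ≡⟨ cong (λ k → x ▷ a ^ k) (m+[n∸m]≡n (<⇒≤ n<d)) ⟩
          x ▷ a ^ d                 ≡⟨ cong (x ▷_) a^d≡ε ⟩
          x ▷ ε                     ≡⟨ act-identity x ⟩
          x                         ∎
          where open ≡-Reasoning

      orbit-trans : ∀ {x y z} → y ∈ orbit x → z ∈ orbit y → z ∈ orbit x
      orbit-trans {x} y∈ z∈ with m , _ , refl ← ∈-orbit⁻ y∈ | n , _ , refl ← ∈-orbit⁻ z∈ =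
        subst (_∈ orbit x) (▷^-+ x m n) (∈-orbit x (m + n))

      orbit-unique : ∀ x → (∀ {y k} → y ∈ orbit x → 0 < k → k < d → ¬ y ▷ a ^ k ≡ y) → Unique (orbit x)
      orbit-unique x aperiodic = tabulate⁺ λ {i} {j} → injective i j
        where
        no-collision : ∀ {m n} → m < n → n < d → ¬ x ▷ a ^ m ≡ x ▷ a ^ n
        no-collision {m} {n} m<n n<d eq = aperiodic (∈-orbit x m) (m<n⇒0<n∸m m<n) (≤-<-trans (m∸n≤m n m) n<d) (begin
          (x ▷ a ^ m) ▷ a ^ (n ∸ m) ≡⟨ ▷^-+ x m (n ∸ m) ⟨
          x ▷ a ^ (m + (n ∸ m))     ≡⟨ cong (λ k → x ▷ a ^ k) (m+[n∸m]≡n (<⇒≤ m<n)) ⟩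
          x ▷ a ^ n                 ≡⟨ eq ⟨
          x ▷ a ^ m                 ∎)
          where open ≡-Reasoning
        injective : ∀ (i j : Fin d) → x ▷ a ^ toℕ i ≡ x ▷ a ^ toℕ j → i ≡ j
        injective i j eq with <-cmp (toℕ i) (toℕ j)
        ... | tri< i<j _ _ = contradiction eq (no-collision i<j (toℕ<n j))
        ... | tri≈ _ i≡j _ = toℕ-injective i≡j
        ... | tri> _ _ j<i = contradiction (sym eq) (no-collision j<i (toℕ<n i))

    fixed⇒power-fixed : ∀ {x} → Fixed x → ∀ n → x ▷ a ^ n ≡ x
    fixed⇒power-fixed {x} x▷a≡x zero    = act-identity x
    fixed⇒power-fixed {x} x▷a≡x (suc n) = begin
      x ▷ (a ∙ a ^ n) ≡⟨ act-∙ x a (a ^ n) ⟩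
      x ▷ a ▷ a ^ n   ≡⟨ cong (_▷ a ^ n) x▷a≡x ⟩
      x ▷ a ^ n       ≡⟨ fixed⇒power-fixed x▷a≡x n ⟩
      x               ∎
      where open ≡-Reasoning

    closed⇒^-closed : ∀ {S : Pred X 0ℓ} → (∀ {x} → S x → S (x ▷ a)) → ∀ {x} n → S x → S (x ▷ a ^ n)
    closed⇒^-closed {S} closed {x} zero    Sx = subst S (sym (act-identity x)) Sx
    closed⇒^-closed {S} closed {x} (suc n) Sx = subst S (sym (act-∙ x a (a ^ n))) (closed⇒^-closed {S} closed n (closed Sx))

    period-+ : ∀ {x} m n → x ▷ a ^ m ≡ x → x ▷ a ^ n ≡ x → x ▷ a ^ (m + n) ≡ x
    period-+ {x} m n pm pn = trans (▷^-+ x m n) (trans (cong (_▷ a ^ n) pm) pn)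

    period-* : ∀ {x} m → x ▷ a ^ m ≡ x → ∀ q → x ▷ a ^ (q * m) ≡ x
    period-* {x} m pm zero    = act-identity x
    period-* {x} m pm (suc q) = period-+ m (q * m) pm (period-* m pm q)

    period-∸ : ∀ {x} m n → x ▷ a ^ m ≡ x → x ▷ a ^ (n + m) ≡ x → x ▷ a ^ n ≡ x
    period-∸ {x} m n pm pnm = begin
      x ▷ a ^ n           ≡⟨ cong (_▷ a ^ n) pm ⟨
      x ▷ a ^ m ▷ a ^ n   ≡⟨ ▷^-+ x m n ⟨
      x ▷ a ^ (m + n)     ≡⟨ cong (λ k → x ▷ a ^ k) (+-comm m n) ⟩
      x ▷ a ^ (n + m)     ≡⟨ pnm ⟩
      x                   ∎
      where open ≡-Reasoning

    module PrimeOrder (p : ℕ) (p-prime : Prime p) (a^p≡ε : a ^ p ≡ ε) where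

      instance _ = prime⇒nonZero p-prime
      open Periodic p a^p≡ε public

      period-p : ∀ x q → x ▷ a ^ (q * p) ≡ x
      period-p x q = trans (cong (x ▷_) (^-multiple a^p≡ε q)) (act-identity x)

      -- The exponents n with x ▷ a ^ n ≡ x are closed under sums and differences, and by
      -- Bézout 1 is an integer combination of k and p.
      power-fixed⇒fixed : ∀ {x k} → 0 < k → k < p → x ▷ a ^ k ≡ x → Fixed x
      power-fixed⇒fixed {x} {k} 0<k k<p pk = subst (λ b → x ▷ b ≡ x) (identityʳ a) period-1
        where
        instance _ = >-nonZero 0<k
        period-1 : x ▷ a ^ 1 ≡ x
        period-1 with coprime-Bézout (prime⇒coprime p-prime k<p)
        ... | Bézout.+- u v 1+vk≡up =
          period-∸ (v * k) 1 (period-* k pk v) (trans (cong (λ n → x ▷ a ^ n) 1+vk≡up) (period-p x u))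
        ... | Bézout.-+ u v 1+up≡vk =
          period-∸ (u * p) 1 (period-p x u) (trans (cong (λ n → x ▷ a ^ n) 1+up≡vk) (period-* k pk v))

      fixed-along-orbit : ∀ {x y} → y ∈ orbit x → Fixed y → Fixed x
      fixed-along-orbit {x} {y} y∈ y-fixed with n , _ , x≡ ← ∈-orbit⁻ (orbit-sym y∈) =
        subst Fixed (trans (sym (fixed⇒power-fixed y-fixed n)) (sym x≡)) y-fixed

      nonfixed-orbit-unique : ∀ {x} → ¬ Fixed x → Unique (orbit x)
      nonfixed-orbit-unique {x} x-moves = orbit-unique x λ y∈ 0<k k<p pk →
        x-moves (fixed-along-orbit y∈ (power-fixed⇒fixed 0<k k<p pk))

      module _ (_≟_ : DecidableEquality X) where

        fixed? : Decidable Fixed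
        fixed? x = (x ▷ a) ≟ x

        nonfixed⇒p≤length : ∀ {x ys} → ¬ Fixed x → orbit x ⊆ ys → p ≤ length ys
        nonfixed⇒p≤length {x} x-moves orbit⊆ys =
          subst (_≤ _) (orbit-length x) (unique-⊆⇒length≤ _≟_ (nonfixed-orbit-unique x-moves) orbit⊆ys)

        p∣#nonfixed : ∀ {xs} → Unique xs → (∀ x → x ∈ xs) → p ∣ length (filter (∁? fixed?) xs)
        p∣#nonfixed {xs} xs-unique xs-complete =
          orbit-length∣length (filter (∁? fixed?) xs) (filter⁺ (∁? fixed?) xs-unique)
            (proj₂ ∘ ∈-filter⁻ (∁? fixed?) {xs = xs})
            (λ x∈ y∈ → ∈-filter⁺ (∁? fixed?) (xs-complete _) λ y-fixed →
               proj₂ (∈-filter⁻ (∁? fixed?) {xs = xs} x∈) (fixed-along-orbit y∈ y-fixed))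
          where
          open OrbitPartition _≟_ (∁ Fixed) orbit p nonfixed-orbit-unique (λ {x} _ → orbit-length x)
                 (λ {x} _ → orbit-refl x) (λ _ _ → orbit-sym) (λ _ _ _ → orbit-trans)


  module Cosets (_≟_ : DecidableEquality M) {H : List M} (H-unique : Unique H) (ε∈H : ε ∈ H)
    (H-closed : ∀ {b c} → b ∈ H → c ∈ H → b ∙ c ∈ H)
    (H-inverse : ∀ {b} → b ∈ H → ∃ λ c → c ∈ H × b ∙ c ≡ ε) where

    coset : M → List M
    coset x = map (x ∙_) H

    private
      ∈-coset⁻ : ∀ {x y} → y ∈ coset x → ∃ λ b → b ∈ H × y ≡ x ∙ b
      ∈-coset⁻ = ∈-map⁻ _

      coset-sym : ∀ {x y} → y ∈ coset x → x ∈ coset y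
      coset-sym {x} y∈ with b , b∈H , refl ← ∈-coset⁻ y∈ =
        let c , c∈H , b∙c≡ε = H-inverse b∈H
        in subst (_∈ coset (x ∙ b)) (trans (assoc x b c) (trans (cong (x ∙_) b∙c≡ε) (identityʳ x))) (∈-map⁺ _ c∈H)

      coset-trans : ∀ {x y z} → y ∈ coset x → z ∈ coset y → z ∈ coset x
      coset-trans {x} y∈ z∈ with b , b∈H , refl ← ∈-coset⁻ y∈ | c , c∈H , refl ← ∈-coset⁻ z∈ =
        subst (_∈ coset x) (sym (assoc x b c)) (∈-map⁺ _ (H-closed b∈H c∈H))

      open OrbitPartition _≟_ Cancellableˡ coset (length H)
        (λ x-cancel → map⁺ x-cancel H-unique) (λ _ → length-map _ H)
        (λ {x} _ → subst (_∈ coset x) (identityʳ x) (∈-map⁺ _ ε∈H))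
        (λ _ _ → coset-sym) (λ _ _ _ → coset-trans)

    lagrange : ∀ {S} → Unique S → (∀ {x} → x ∈ S → Cancellableˡ x) →
               (∀ {x b} → x ∈ S → b ∈ H → x ∙ b ∈ S) → length H ∣ length S
    lagrange {S} S-unique S-cancel S-closed =
      orbit-length∣length S S-unique S-cancel coset⊆S
      where
      coset⊆S : ∀ {x} → x ∈ S → coset x ⊆ S
      coset⊆S x∈S y∈ with _ , b∈H , refl ← ∈-coset⁻ y∈ = S-closed x∈S b∈H

  module FiniteGroup (_≟_ : DecidableEquality M) {G : List M} (G-unique : Unique G) (ε∈G : ε ∈ G)
    (G-closed : ∀ {b c} → b ∈ G → c ∈ G → b ∙ c ∈ G) (G-cancel : ∀ {b} → b ∈ G → Cancellableˡ b) where

    ^∈G : ∀ {a} → a ∈ G → ∀ n → a ^ n ∈ G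
    ^∈G a∈G zero    = ε∈G
    ^∈G a∈G (suc n) = G-closed a∈G (^∈G a∈G n)

    has-period : ∀ {a} → a ∈ G → ∃ λ m → a ^ suc m ≡ ε
    has-period {a} a∈G
      with i , j , i<j , same-index ← pigeonhole (n<1+n (length G)) (λ (i : Fin _) → index (^∈G a∈G (toℕ i))) =
      let k , i+1+k≡j = m≤n⇒∃[o]m+o≡n i<j in
      k , G-cancel (^∈G a∈G (toℕ i)) (begin
        a ^ toℕ i ∙ a ^ suc k ≡⟨ Power.×-homo-+ a (toℕ i) (suc k) ⟨
        a ^ (toℕ i + suc k)   ≡⟨ cong (a ^_) (trans (+-suc (toℕ i) k) i+1+k≡j) ⟩
        a ^ toℕ j             ≡⟨ index-injective (^∈G a∈G (toℕ j)) (^∈G a∈G (toℕ i)) (sym same-index) ⟩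
        a ^ toℕ i             ≡⟨ identityʳ (a ^ toℕ i) ⟨
        a ^ toℕ i ∙ ε         ∎)
      where open ≡-Reasoning

    least-period∣length : ∀ {a} → a ∈ G → ∀ m → a ^ suc m ≡ ε → (∀ {k} → k < m → ¬ a ^ suc k ≡ ε) →
                          suc m ∣ length G
    least-period∣length {a} a∈G m a^d≡ε minimal =
      subst (_∣ length G) (orbit-length ε) (lagrange G-unique G-cancel (λ x∈G b∈H → G-closed x∈G (H⊆G b∈H)))
      where
      open RightAction _∙_ identityʳ (λ x b c → sym (assoc x b c)) a
      open Periodic (suc m) a^d≡ε

      -- The cyclic subgroup generated by a, as the orbit of ε under right multiplication.
      H = orbit ε

      H⊆G : ∀ {b} → b ∈ H → b ∈ G
      H⊆G b∈H with n , _ , refl ← ∈-orbit⁻ b∈H = subst (_∈ G) (sym (identityˡ (a ^ n))) (^∈G a∈G n)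

      aperiodic : ∀ {y k} → y ∈ H → 0 < k → k < suc m → ¬ y ∙ a ^ k ≡ y
      aperiodic {y} {suc k} y∈H _ k<d y∙a^k≡y =
        minimal (≤-pred k<d) (G-cancel (H⊆G y∈H) (trans y∙a^k≡y (sym (identityʳ y))))

      H-closed : ∀ {b c} → b ∈ H → c ∈ H → b ∙ c ∈ H
      H-closed {b} b∈H c∈H with n , _ , refl ← ∈-orbit⁻ c∈H =
        subst (_∈ H) (cong (b ∙_) (sym (identityˡ (a ^ n)))) (orbit-trans b∈H (∈-orbit b n))

      H-inverse : ∀ {b} → b ∈ H → ∃ λ c → c ∈ H × b ∙ c ≡ ε
      H-inverse {b} b∈H with k , _ , ε≡b∙a^k ← ∈-orbit⁻ (orbit-sym b∈H) =
        ε ∙ a ^ k , ∈-orbit ε k , trans (cong (b ∙_) (identityˡ (a ^ k))) (sym ε≡b∙a^k)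

      open Cosets _≟_ {H} (orbit-unique ε aperiodic) (orbit-refl ε) H-closed H-inverse

    ^-length≡ε : ∀ {a} → a ∈ G → a ^ length G ≡ ε
    ^-length≡ε {a} a∈G =
      let m₀ , a^1+m₀≡ε = has-period a∈G
          m , a^1+m≡ε , minimal = least-witness (λ m → (a ^ suc m) ≟ ε) m₀ a^1+m₀≡ε
      in ^-∣ a^1+m≡ε (least-period∣length a∈G m a^1+m≡ε minimal)

xor-isAbelianGroup : ∀ n → IsAbelianGroup _≡_ (zipWith {n = n} _xor_) (replicate n false) id
xor-isAbelianGroup n = record
  { isGroup = record
    { isMonoid = record
      { isSemigroup = record
        { isMagma = record { isEquivalence = isEquivalence ; ∙-cong = cong₂ _ }
        ; assoc = λ u v w → Pointwise-≡⇒≡ (zipWith-assoc Bool.xor-assoc u v w) }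
      ; identity = (λ v → Pointwise-≡⇒≡ (zipWith-identityˡ Bool.xor-identityˡ v))
                 , (λ v → Pointwise-≡⇒≡ (zipWith-identityʳ Bool.xor-identityʳ v)) }
    ; inverse = xor-self , xor-self
    ; ⁻¹-cong = cong id }
  ; comm = λ u v → Pointwise-≡⇒≡ (zipWith-comm Bool.xor-comm u v) }
  where
  xor-self : ∀ {n} (v : Vec Bool n) → zipWith _xor_ v v ≡ replicate n false
  xor-self []      = refl
  xor-self (x ∷ v) = cong₂ _∷_ (Bool.xor-same x) (xor-self v)

xor-abelianGroup : ℕ → AbelianGroup 0ℓ 0ℓ
xor-abelianGroup n = record { isAbelianGroup = xor-isAbelianGroup n }

module ⊕ {n : ℕ} where
  open AbelianGroup (xor-abelianGroup n) public using (identityˡ; identityʳ; inverseʳ; isMonoid)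
  open AbelianGroupProperties (xor-abelianGroup n) public using (∙-cancelˡ; inverseʳ-unique)
  open CommutativeSemigroupProperties (AbelianGroup.commutativeSemigroup (xor-abelianGroup n)) public using (interchange)

scale-xor : ∀ x y b → scale (x xor y) b ≡ scale x b ⊕ scale y b
scale-xor true  true  b = sym (⊕.inverseʳ b)
scale-xor true  false b = sym (⊕.identityʳ b)
scale-xor false y     b = sym (⊕.identityˡ (scale y b))

lincomb-zero : ∀ {k} (bs : Vec V k) → lincomb (replicate k false) bs ≡ zeroV
lincomb-zero []       = refl
lincomb-zero (b ∷ bs) = trans (⊕.identityˡ _) (lincomb-zero bs)

lincomb-xor : ∀ {k} (c c′ : Vecₙ k) (bs : Vec V k) →
              lincomb (zipWith _xor_ c c′) bs ≡ lincomb c bs ⊕ lincomb c′ bs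
lincomb-xor []      []       []       = sym (⊕.identityˡ zeroV)
lincomb-xor (x ∷ c) (y ∷ c′) (b ∷ bs) = begin
  scale (x xor y) b ⊕ lincomb (zipWith _xor_ c c′) bs      ≡⟨ cong₂ _⊕_ (scale-xor x y b) (lincomb-xor c c′ bs) ⟩
  (scale x b ⊕ scale y b) ⊕ (lincomb c bs ⊕ lincomb c′ bs) ≡⟨ ⊕.interchange _ _ _ _ ⟩
  (scale x b ⊕ lincomb c bs) ⊕ (scale y b ⊕ lincomb c′ bs) ∎
  where open ≡-Reasoning

lincomb-injective : ∀ {k} {bs : Vec V k} → Independent bs → ∀ {c c′} → lincomb c bs ≡ lincomb c′ bs → c ≡ c′
lincomb-injective {bs = bs} indep {c} {c′} eq = sym (⊕.inverseʳ-unique c c′ (indep (zipWith _xor_ c c′) (begin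
  lincomb (zipWith _xor_ c c′) bs ≡⟨ lincomb-xor c c′ bs ⟩
  lincomb c bs ⊕ lincomb c′ bs    ≡⟨ cong (_⊕ lincomb c′ bs) eq ⟩
  lincomb c′ bs ⊕ lincomb c′ bs   ≡⟨ ⊕.inverseʳ _ ⟩
  zeroV                           ∎)))
  where open ≡-Reasoning

·-⊕ : ∀ u v A → (u ⊕ v) · A ≡ (u · A) ⊕ (v · A)
·-⊕ u v A = lincomb-xor u v A

zeroV· : ∀ A → zeroV · A ≡ zeroV
zeroV· A = lincomb-zero A

scale-· : ∀ c b A → scale c b · A ≡ scale c (b · A)
scale-· true  b A = refl
scale-· false b A = zeroV· A

lincomb-· : ∀ {k} (c : Vecₙ k) (bs : Vec V k) A → lincomb c (mapᵥ (_· A) bs) ≡ lincomb c bs · A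
lincomb-· []       []       A = sym (zeroV· A)
lincomb-· (x ∷ c) (b ∷ bs) A = begin
  scale x (b · A) ⊕ lincomb c (mapᵥ (_· A) bs) ≡⟨ cong₂ _⊕_ (sym (scale-· x b A)) (lincomb-· c bs A) ⟩
  (scale x b · A) ⊕ (lincomb c bs · A)         ≡⟨ ·-⊕ (scale x b) (lincomb c bs) A ⟨
  (scale x b ⊕ lincomb c bs) · A               ∎
  where open ≡-Reasoning

·-*ₘ : ∀ u B C → u · (B *ₘ C) ≡ (u · B) · C
·-*ₘ u B C = lincomb-· u B C

*ₘ-assoc : ∀ A B C → (A *ₘ B) *ₘ C ≡ A *ₘ (B *ₘ C)
*ₘ-assoc A B C = trans (sym (map-∘ (_· C) (_· B) A)) (map-cong (λ u → sym (·-*ₘ u B C)) A)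

allVec : ∀ n → List (Vecₙ n)
allVec zero    = [] ∷ []
allVec (suc n) = map (true ∷_) (allVec n) ++ map (false ∷_) (allVec n)

∈-allVec : ∀ {n} (v : Vecₙ n) → v ∈ allVec n
∈-allVec []          = here refl
∈-allVec (true ∷ v)  = ∈-++⁺ˡ (∈-map⁺ (true ∷_) (∈-allVec v))
∈-allVec (false ∷ v) = ∈-++⁺ʳ _ (∈-map⁺ (false ∷_) (∈-allVec v))

allVec-unique : ∀ n → Unique (allVec n)
allVec-unique zero    = [] ∷ []
allVec-unique (suc n) = ++⁺ (map⁺ ∷-injectiveʳ (allVec-unique n)) (map⁺ ∷-injectiveʳ (allVec-unique n)) disjoint
  where
  disjoint : ∀ {v} → ¬ (v ∈ map (true ∷_) (allVec n) × v ∈ map (false ∷_) (allVec n))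
  disjoint (v∈ , v∈′) with _ , _ , refl ← ∈-map⁻ _ v∈ | _ , _ , () ← ∈-map⁻ _ v∈′

length-allVec : ∀ n → length (allVec n) ≡ 2 ℕ.^ n
length-allVec zero    = refl
length-allVec (suc n) = begin
  length (map (true ∷_) (allVec n) ++ map (false ∷_) (allVec n))          ≡⟨ length-++ (map (true ∷_) (allVec n)) ⟩
  length (map (true ∷_) (allVec n)) + length (map (false ∷_) (allVec n)) ≡⟨ cong₂ _+_ (length-map _ (allVec n))
                                                                                         (length-map _ (allVec n)) ⟩
  length (allVec n) + length (allVec n)                                   ≡⟨ cong (λ m → m + m) (length-allVec n) ⟩
  2 ℕ.^ n + 2 ℕ.^ n                                                       ≡⟨ cong (2 ℕ.^ n +_) (+-identityʳ (2 ℕ.^ n)) ⟨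
  2 ℕ.^ suc n                                                             ∎
  where open ≡-Reasoning

_≟V_ : DecidableEquality V
_≟V_ = ≡-dec Bool._≟_

·-Iₘ : ∀ u → u · Iₘ ≡ u
·-Iₘ u = All.lookup (toWitness {a? = all? (λ u → (u · Iₘ) ≟V u) (allVec 7)} tt) (∈-allVec u)

*ₘ-identityʳ : ∀ A → A *ₘ Iₘ ≡ A
*ₘ-identityʳ A = trans (map-cong ·-Iₘ A) (map-id A)

lincomb-unit : ∀ {m n} (xs : Vec V m) b (ys : Vec V n) →
               lincomb (replicate m false ++ᵥ true ∷ replicate n false) (xs ++ᵥ b ∷ ys) ≡ b
lincomb-unit []       b ys = trans (cong (b ⊕_) (lincomb-zero ys)) (⊕.identityʳ b)
lincomb-unit (x ∷ xs) b ys = trans (⊕.identityˡ _) (lincomb-unit xs b ys)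

-- Row i of Iₘ reduces to replicate i false ++ᵥ true ∷ replicate (6 ∸ i) false.
*ₘ-identityˡ : ∀ A → Iₘ *ₘ A ≡ A
*ₘ-identityˡ (r₀ ∷ r₁ ∷ r₂ ∷ r₃ ∷ r₄ ∷ r₅ ∷ r₆ ∷ []) = Pointwise-≡⇒≡
  ( lincomb-unit [] r₀ (r₁ ∷ r₂ ∷ r₃ ∷ r₄ ∷ r₅ ∷ r₆ ∷ [])
  ∷ lincomb-unit (r₀ ∷ []) r₁ (r₂ ∷ r₃ ∷ r₄ ∷ r₅ ∷ r₆ ∷ [])
  ∷ lincomb-unit (r₀ ∷ r₁ ∷ []) r₂ (r₃ ∷ r₄ ∷ r₅ ∷ r₆ ∷ [])
  ∷ lincomb-unit (r₀ ∷ r₁ ∷ r₂ ∷ []) r₃ (r₄ ∷ r₅ ∷ r₆ ∷ [])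
  ∷ lincomb-unit (r₀ ∷ r₁ ∷ r₂ ∷ r₃ ∷ []) r₄ (r₅ ∷ r₆ ∷ [])
  ∷ lincomb-unit (r₀ ∷ r₁ ∷ r₂ ∷ r₃ ∷ r₄ ∷ []) r₅ (r₆ ∷ [])
  ∷ lincomb-unit (r₀ ∷ r₁ ∷ r₂ ∷ r₃ ∷ r₄ ∷ r₅ ∷ []) r₆ []
  ∷ [] )

*ₘ-isMonoid : IsMonoid _≡_ _*ₘ_ Iₘ
*ₘ-isMonoid = record
  { isSemigroup = record { isMagma = record { isEquivalence = isEquivalence ; ∙-cong = cong₂ _*ₘ_ } ; assoc = *ₘ-assoc }
  ; identity = *ₘ-identityˡ , *ₘ-identityʳ }

_≟M_ : DecidableEquality Matrix
_≟M_ = ≡-dec _≟V_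

fixes-all⇒≡Iₘ : ∀ {A} → (∀ u → u · A ≡ u) → A ≡ Iₘ
fixes-all⇒≡Iₘ {A} fixes = begin
  A          ≡⟨ *ₘ-identityˡ A ⟨
  Iₘ *ₘ A    ≡⟨ map-cong fixes Iₘ ⟩
  mapᵥ id Iₘ ≡⟨ map-id Iₘ ⟩
  Iₘ         ∎
  where open ≡-Reasoning

elements : ∀ {k} → Subspace k → List V
elements {k} U = map (λ c → lincomb c (proj₁ U)) (allVec k)

∈-elements : ∀ {k} (U : Subspace k) {v} → ⟦ U ⟧ v → v ∈ elements U
∈-elements U (c , refl) = ∈-map⁺ _ (∈-allVec c)

∈-elements⁻ : ∀ {k} (U : Subspace k) {v} → v ∈ elements U → ⟦ U ⟧ v
∈-elements⁻ U v∈ = let c , _ , v≡ = ∈-map⁻ _ v∈ in c , sym v≡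

elements-unique : ∀ {k} (U : Subspace k) → Unique (elements U)
elements-unique {k} (bs , independent) = map⁺ (lincomb-injective independent) (allVec-unique k)

length-elements : ∀ {k} (U : Subspace k) → length (elements U) ≡ 2 ℕ.^ k
length-elements {k} U = trans (length-map _ (allVec k)) (length-allVec k)

⟦⟧-zeroV : ∀ {k} (U : Subspace k) → ⟦ U ⟧ zeroV
⟦⟧-zeroV {k} (bs , _) = replicate k false , lincomb-zero bs

⟦⟧-⊕ : ∀ {k} (U : Subspace k) {u v} → ⟦ U ⟧ u → ⟦ U ⟧ v → ⟦ U ⟧ (u ⊕ v)
⟦⟧-⊕ (bs , _) (c , refl) (c′ , refl) = zipWith _xor_ c c′ , lincomb-xor c c′ bs

independent-pair : ∀ {a b} → ¬ a ≡ zeroV → ¬ b ≡ zeroV → ¬ a ≡ b → Independent (a ∷ b ∷ [])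
independent-pair {a} {b} _   _   a≢b (true  ∷ true  ∷ []) eq =
  contradiction (sym (⊕.inverseʳ-unique a b (trans (cong (a ⊕_) (sym (⊕.identityʳ b))) eq))) a≢b
independent-pair {a} {b} a≢0 _   _   (true  ∷ false ∷ []) eq = contradiction (trans (sym (⊕.identityʳ a)) eq) a≢0
independent-pair {a} {b} _   b≢0 _   (false ∷ true  ∷ []) eq =
  contradiction (trans (sym (trans (⊕.identityˡ _) (⊕.identityʳ b))) eq) b≢0
independent-pair         _   _   _   (false ∷ false ∷ []) _  = refl

Fixes : Matrix → V → Set
Fixes A v = v · A ≡ v

fixes? : ∀ A → Decidable (Fixes A)
fixes? A v = (v · A) ≟V v

fixedVectors : Matrix → List V
fixedVectors A = filter (fixes? A) (allVec 7)

span-fixed : ∀ {k} A {bs : Vec V k} → mapᵥ (_· A) bs ≡ bs → ∀ {v} → Span bs v → Fixes A v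
span-fixed A {bs} bs·A≡bs (c , refl) = trans (sym (lincomb-· c bs A)) (cong (lincomb c) bs·A≡bs)

∈-fixedVectors : ∀ {A v} → Fixes A v → v ∈ fixedVectors A
∈-fixedVectors {A} {v} = ∈-filter⁺ (fixes? A) (∈-allVec v)

∈-fixedVectors⁻ : ∀ {A v} → v ∈ fixedVectors A → Fixes A v
∈-fixedVectors⁻ {A} = proj₂ ∘ ∈-filter⁻ (fixes? A) {xs = allVec 7}

fixedVectors-unique : ∀ A → Unique (fixedVectors A)
fixedVectors-unique A = filter⁺ (fixes? A) (allVec-unique 7)

pointwise-fixed-2-subspace : ∀ A → 3 ≤ length (fixedVectors A) → Σ (Subspace 2) λ W → ∀ {w} → ⟦ W ⟧ w → Fixes A w
pointwise-fixed-2-subspace A 3≤#fixed =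
  let a , a∈ , a∉[0]   = unique-length<⇒∉ _≟V_ {ys = zeroV ∷ []} (fixedVectors-unique A) (≤-trans (n≤1+n 2) 3≤#fixed)
      b , b∈ , b∉[0,a] = unique-length<⇒∉ _≟V_ {ys = zeroV ∷ a ∷ []} (fixedVectors-unique A) 3≤#fixed
  in (a ∷ b ∷ [] , independent-pair (a∉[0] ∘ here) (b∉[0,a] ∘ here) (b∉[0,a] ∘ there ∘ here ∘ sym))
   , span-fixed A (cong₂ _∷_ (∈-fixedVectors⁻ a∈) (cong₂ _∷_ (∈-fixedVectors⁻ b∈) refl))

block-through-fixed-2-subspace-invariant :
  ∀ {𝒟 A} → IsQFano 𝒟 → InvariantUnder 𝒟 A → (W : Subspace 2) → (∀ {w} → ⟦ W ⟧ w → Fixes A w) →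
  Σ (Subspace 3) λ C → ∀ {v} → ⟦ C ⟧ v → ⟦ C ⟧ (v · A)
block-through-fixed-2-subspace-invariant {A = A} fano (images∈𝒟 , _) W W-fixed =
  let C , C∈𝒟 , W⊆C , C-unique = fano W
      C′ , C′∈𝒟 , C′≐CA = find (images∈𝒟 C C∈𝒟)
      C′≐C = C-unique C′ C′∈𝒟 λ w w∈W → proj₂ C′≐CA w (w , W⊆C w w∈W , W-fixed w∈W)
  in C , λ {v} v∈C → proj₁ C′≐C (v · A) (proj₂ C′≐CA (v · A) (v , v∈C , refl))

module MatrixMonoid = MonoidTheory *ₘ-isMonoid
module VectorMonoid = MonoidTheory (⊕.isMonoid {7})

open MatrixMonoid using (module FiniteGroup; left-invertible⇒cancellableˡ) renaming (_^_ to _^ₘ_)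

pointwise-fixed⇒2^k∣#fixed : ∀ {k} A (U : Subspace k) → (∀ {u} → ⟦ U ⟧ u → Fixes A u) →
                             2 ℕ.^ k ∣ length (fixedVectors A)
pointwise-fixed⇒2^k∣#fixed A U U-fixed =
  subst (_∣ length (fixedVectors A)) (length-elements U)
        (lagrange (fixedVectors-unique A) (λ {x} _ → ⊕.∙-cancelˡ x _ _) closed)
  where
  open VectorMonoid.Cosets _≟V_ (elements-unique U) (∈-elements U (⟦⟧-zeroV U))
    (λ b∈ c∈ → ∈-elements U (⟦⟧-⊕ U (∈-elements⁻ U b∈) (∈-elements⁻ U c∈)))
    (λ {b} b∈ → b , b∈ , ⊕.inverseʳ b)
  closed : ∀ {x b} → x ∈ fixedVectors A → b ∈ elements U → (x ⊕ b) ∈ fixedVectors A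
  closed {x} {b} x∈ b∈ =
    ∈-fixedVectors (trans (·-⊕ x b A) (cong₂ _⊕_ (∈-fixedVectors⁻ x∈) (U-fixed (∈-elements⁻ U b∈))))

#fixed≡128⇒≡Iₘ : ∀ A → length (fixedVectors A) ≡ 128 → A ≡ Iₘ
#fixed≡128⇒≡Iₘ A #fixed≡128 = fixes-all⇒≡Iₘ λ u →
  ∈-fixedVectors⁻ (subst (u ∈_) (sym (filter-complete (fixes? A) {xs = allVec 7} #fixed≡128)) (∈-allVec u))

-- 128 ∸ 31q for q = 0, …, 4 is one of 128, 97, 66, 35, 4.
31∣128∸f⇒3≤f : ∀ {f} → f < 129 → 31 ∣ 128 ∸ f → 3 ≤ f
31∣128∸f⇒3≤f = toWitness {a? = allUpTo? (λ f → (31 ∣? (128 ∸ f)) →-dec (3 ≤? f)) 129} tt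

31∣128∸f∧8∣f⇒f≡128 : ∀ {f} → f < 129 → 31 ∣ 128 ∸ f → 8 ∣ f → f ≡ 128
31∣128∸f∧8∣f⇒f≡128 =
  toWitness {a? = allUpTo? (λ f → (31 ∣? (128 ∸ f)) →-dec ((8 ∣? f) →-dec (f ℕ.≟ 128))) 129} tt

module _ (A : Matrix) (A^31≡Iₘ : A ^ₘ 31 ≡ Iₘ) where

  open MatrixMonoid.RightAction _·_ ·-Iₘ ·-*ₘ A using (closed⇒^-closed; module PrimeOrder)
  open PrimeOrder 31 (from-yes (prime? 31)) A^31≡Iₘ using (orbit; ∈-orbit⁻; nonfixed⇒p≤length; p∣#nonfixed)

  private
    #fixed<129 : length (fixedVectors A) < 129
    #fixed<129 = s≤s (length-filter (fixes? A) (allVec 7))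

    31∣128∸#fixed : 31 ∣ 128 ∸ length (fixedVectors A)
    31∣128∸#fixed = subst (31 ∣_) #moved≡128∸#fixed (p∣#nonfixed _≟V_ (allVec-unique 7) ∈-allVec)
      where
      #moved≡128∸#fixed : length (filter (∁? (fixes? A)) (allVec 7)) ≡ 128 ∸ length (fixedVectors A)
      #moved≡128∸#fixed = trans (sym (m+n∸m≡n (length (fixedVectors A)) _))
                                (cong (_∸ length (fixedVectors A)) (length-filter-∁ (fixes? A) (allVec 7)))

  3≤#fixed : 3 ≤ length (fixedVectors A)
  3≤#fixed = 31∣128∸f⇒3≤f #fixed<129 31∣128∸#fixed

  8∣#fixed⇒#fixed≡128 : 8 ∣ length (fixedVectors A) → length (fixedVectors A) ≡ 128
  8∣#fixed⇒#fixed≡128 = 31∣128∸f∧8∣f⇒f≡128 #fixed<129 31∣128∸#fixed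

  invariant⇒pointwise-fixed : (C : Subspace 3) → (∀ {v} → ⟦ C ⟧ v → ⟦ C ⟧ (v · A)) →
                              ∀ {v} → ⟦ C ⟧ v → Fixes A v
  invariant⇒pointwise-fixed C C-invariant {v} v∈C with fixes? A v
  ... | yes v-fixed = v-fixed
  ... | no  v-moves =
    contradiction (subst (31 ≤_) (length-elements C) (nonfixed⇒p≤length _≟V_ v-moves orbit⊆C)) (from-no (31 ≤? 8))
    where
    orbit⊆C : orbit v ⊆ elements C
    orbit⊆C w∈ with n , _ , refl ← ∈-orbit⁻ {v} w∈ = ∈-elements C (closed⇒^-closed {⟦ C ⟧} C-invariant n v∈C)

lemma19 : (𝒟 : SubspaceSet) → IsQFano 𝒟 →
          (G : List Matrix) → IsSubgroupGL G → length G ≡ 31 →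
          ¬ GInvariant 𝒟 G
lemma19 𝒟 fano G G-subgroup |G|≡31 invariant =
  let A , A∈G , A∉[Iₘ] = unique-length<⇒∉ _≟M_ {ys = Iₘ ∷ []} distinct (subst (1 <_) (sym |G|≡31) (s≤s (s≤s z≤n)))
      A^31≡Iₘ = subst (λ n → A ^ₘ n ≡ Iₘ) |G|≡31 (^-length≡ε A∈G)
      W , W-fixed = pointwise-fixed-2-subspace A (3≤#fixed A A^31≡Iₘ)
      C , C-invariant = block-through-fixed-2-subspace-invariant fano (invariant A A∈G) W W-fixed
      8∣#fixed = pointwise-fixed⇒2^k∣#fixed A C (invariant⇒pointwise-fixed A A^31≡Iₘ C C-invariant)
  in A∉[Iₘ] (here (#fixed≡128⇒≡Iₘ A (8∣#fixed⇒#fixed≡128 A A^31≡Iₘ 8∣#fixed)))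
  where
  open IsSubgroupGL G-subgroup
  G-cancel : ∀ {B} → B ∈ G → MatrixMonoid.Cancellableˡ B
  G-cancel {B} B∈G = let _ , _ , _ , B′B≡Iₘ = closedInv B B∈G in left-invertible⇒cancellableˡ B′B≡Iₘ
  open FiniteGroup _≟M_ distinct hasId (closedMul _ _) G-cancel using (^-length≡ε)
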